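{- There exists a Kalmar elementary functional $\varphi$ of type 2 (more precisely, given by a closed term of the system $G_3A^{\omega}$) such that for every function $f:\mathbb{N}\to\mathbb{N}$ representing an infinite binary tree and every modulus of regularity $\rho:\mathbb{N}\to\mathbb{N}$ for $f$ with respect to infinite paths through $f$, $\varphi(f,\rho)$ is the leftmost (lexicographically least) infinite path through $f$.
   Context: Finite sequences of natural numbers are coded by natural numbers via a fixed primitive recursive coding; $n*m$ denotes the code of the concatenation, $\langle x\rangle$ the one-element sequence, $lth(n)$ the length, and $\overline{b}x$ the code of $(b(0),\dots,b(x-1))$. A function $f:\mathbb{N}\to\mathbb{N}$ represents a binary tree if $\forall n,m\,(f(n*m)=0\to f(n)=0)$ and $\forall n,x\,(f(n*\langle x\rangle)=0\to x\le 1)$; it represents an infinite binary tree if moreover $\forall x\,\exists n\,(lth(n)=x\wedge f(n)=0)$. An infinite path through $f$ is a $b:\mathbb{N}\to\{0,1\}$ with $f(\overline{b}x)=0$ for all $x$. A function $\rho:\mathbb{N}\to\mathbb{N}$ is a modulus of regularity for $f$ w.r.t. infinite paths through $f$ if for all $h:\mathbb{N}\to\{0,1\}$ and all $k\in\mathbb{N}$: if $f(\overline{h}(\rho(k)))=0$ then there is an infinite path $b$ through $f$ with $\overline{h}k=\overline{b}k$. $G_3A^{\omega}$ is Kohlenbach's fragment of arithmetic in all finite types whose closed terms define exactly (the type-2 extensions of) Kalmar elementary computable functionals. -}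

module Defs where

open import Data.Nat using (ℕ; zero; suc; _+_; _*_; _∸_; _^_; _≤_; _<_)
open import Data.Fin using (Fin)
open import Data.Vec using (Vec; _∷_; lookup)
open import Data.List using (List; []; _∷_; _++_; [_]; length; map; upTo)
open import Data.Product using (Σ; _×_; ∃)
open import Relation.Binary.PropositionalEquality using (_≡_)

pair : ℕ → ℕ → ℕ
pair x y = (2 ^ x) * suc (2 * y) ∸ 1

-- code of a finite sequence; every natural number is the code of exactly one list
code : List ℕ → ℕ
code []      = 0
code (x ∷ s) = suc (pair x (code s))

bar : (ℕ → ℕ) → ℕ → ℕ
bar b x = code (map b (upTo x))

IsBinTree : (ℕ → ℕ) → Set
IsBinTree f =
  (∀ (n m : List ℕ) → f (code (n ++ m)) ≡ 0 → f (code n) ≡ 0) ×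
  (∀ (n : List ℕ) (x : ℕ) → f (code (n ++ [ x ])) ≡ 0 → x ≤ 1)

IsInfBinTree : (ℕ → ℕ) → Set
IsInfBinTree f =
  IsBinTree f × (∀ (x : ℕ) → ∃ λ (n : List ℕ) → length n ≡ x × f (code n) ≡ 0)

Binary : (ℕ → ℕ) → Set
Binary h = ∀ i → h i ≤ 1

IsPath : (ℕ → ℕ) → (ℕ → ℕ) → Set
IsPath f b = Binary b × (∀ x → f (bar b x) ≡ 0)

IsModulusOfRegularity : (ℕ → ℕ) → (ℕ → ℕ) → Set
IsModulusOfRegularity f ρ =
  ∀ (h : ℕ → ℕ) → Binary h → ∀ (k : ℕ) →
    f (bar h (ρ k)) ≡ 0 → ∃ λ (b : ℕ → ℕ) → IsPath f b × bar h k ≡ bar b k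

LexLeq : (ℕ → ℕ) → (ℕ → ℕ) → Set
LexLeq g b = ∀ i → (∀ j → j < i → g j ≡ b j) → g i ≤ b i

IsLeftmostPath : (ℕ → ℕ) → (ℕ → ℕ) → Set
IsLeftmostPath f g = IsPath f g × (∀ b → IsPath f b → LexLeq g b)

-- Kalmar elementary functionals of type 2 with two function arguments
-- (f , ρ) and n number arguments: terms built from variables, 0, successor,
-- +, ∸, application of the function arguments, composition (nesting),
-- bounded sums and bounded products.

data Elem (n : ℕ) : Set where
  var  : Fin n → Elem n
  zro  : Elem n
  sc   : Elem n → Elem n
  add  : Elem n → Elem n → Elem n
  monus : Elem n → Elem n → Elem n
  appF : Elem n → Elem n
  appR : Elem n → Elem n
  bsum  : Elem n → Elem (suc n) → Elem n
  bprod : Elem n → Elem (suc n) → Elem n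

sumBelow : ℕ → (ℕ → ℕ) → ℕ
sumBelow zero    g = 0
sumBelow (suc k) g = sumBelow k g + g k

prodBelow : ℕ → (ℕ → ℕ) → ℕ
prodBelow zero    g = 1
prodBelow (suc k) g = prodBelow k g * g k

⟦_⟧ : ∀ {n} → Elem n → (ℕ → ℕ) → (ℕ → ℕ) → Vec ℕ n → ℕ
⟦ var i ⟧ f ρ xs = lookup xs i
⟦ zro ⟧ f ρ xs = 0
⟦ sc t ⟧ f ρ xs = suc (⟦ t ⟧ f ρ xs)
⟦ add s t ⟧ f ρ xs = ⟦ s ⟧ f ρ xs + ⟦ t ⟧ f ρ xs
⟦ monus s t ⟧ f ρ xs = ⟦ s ⟧ f ρ xs ∸ ⟦ t ⟧ f ρ xs
⟦ appF t ⟧ f ρ xs = f (⟦ t ⟧ f ρ xs)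
⟦ appR t ⟧ f ρ xs = ρ (⟦ t ⟧ f ρ xs)
⟦ bsum t s ⟧ f ρ xs = sumBelow (⟦ t ⟧ f ρ xs) (λ i → ⟦ s ⟧ f ρ (i ∷ xs))
⟦ bprod t s ⟧ f ρ xs = prodBelow (⟦ t ⟧ f ρ xs) (λ i → ⟦ s ⟧ f ρ (i ∷ xs))

apply1 : Elem 1 → (ℕ → ℕ) → (ℕ → ℕ) → (ℕ → ℕ)
apply1 t f ρ x = ⟦ t ⟧ f ρ (x ∷ Data.Vec.[])

{-# OPTIONS --safe #-}

-- Fix x and let M = x + 1 + ρ (x + 1).  Read a number i < 2 ^ M as an M-bit string, most
-- significant bit first; then numeric order refines lexicographic order.  So the least i whose
-- string is a node of f gives the lexicographically least node of length M.  Such an i exists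
-- because f is infinite, and this node lies lexicographically below every infinite path.  Because
-- M ≥ ρ (x + 1), the modulus extends the node's first x + 1 bits to an infinite path.  Those bits
-- are therefore the leftmost (x + 1)-prefix of an infinite path.  Such prefixes are unique, hence
-- coherent in x, so the diagonal x ↦ (bit x of the node for x) is the leftmost path.  The search,
-- the bits and the code of a sequence (through a closed form) are bounded sums and products of
-- f and ρ, which gives the elementary term.

module Submission where

open import Defs
open import Data.Nat
  using (ℕ; zero; suc; _+_; _*_; _∸_; _^_; _≤_; _<_; _⊓_; z≤n; s≤s; s≤s⁻¹; z<s; s<s; s<s⁻¹; NonZero)
open import Data.Nat.Properties
open import Data.Nat.DivMod
open import Data.Nat.Divisibility using (n∣m*n)
open import Data.Nat.Tactic.RingSolver using (solve-∀)
open import Data.Fin using (Fin)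
import Data.Fin as Fin
open import Data.Vec using (Vec; _∷_; []; lookup)
open import Data.List using (List; []; _∷_; _++_; [_]; length; applyUpTo)
open import Data.List.Properties using (map-upTo; ++-assoc; ∷-injective)
open import Data.Product using (Σ; _×_; _,_; ∃; proj₁; proj₂)
open import Data.Sum using (inj₁; inj₂)
open import Function using (_∘_)
open import Relation.Binary.PropositionalEquality hiding ([_])
open import Relation.Nullary using (contradiction; yes; no)

private variable
  a i k m M : ℕ
  b f g h s ρ : ℕ → ℕ

-- Initial segments

Agree : ℕ → (ℕ → ℕ) → (ℕ → ℕ) → Set
Agree k g h = ∀ j → j < k → g j ≡ h j

Agree-sym : Agree k g h → Agree k h g
Agree-sym g≈h j j<k = sym (g≈h j j<k)

Agree-trans : Agree k g h → Agree k h s → Agree k g s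
Agree-trans g≈h h≈s j j<k = trans (g≈h j j<k) (h≈s j j<k)

Agree-mono : m ≤ k → Agree k g h → Agree m g h
Agree-mono m≤k g≈h j j<m = g≈h j (<-≤-trans j<m m≤k)

Agree-suc : Agree k g h → g k ≡ h k → Agree (suc k) g h
Agree-suc {k} g≈h gk≡hk j j<1+k with m≤n⇒m<n∨m≡n (s≤s⁻¹ j<1+k)
... | inj₁ j<k  = g≈h j j<k
... | inj₂ refl = gk≡hk

LexLeqBelow : ℕ → (ℕ → ℕ) → (ℕ → ℕ) → Set
LexLeqBelow k g h = ∀ i → i < k → Agree i g h → g i ≤ h i

LexLeqBelow-mono : m ≤ k → LexLeqBelow k g h → LexLeqBelow m g h
LexLeqBelow-mono m≤k g≤h i i<m = g≤h i (<-≤-trans i<m m≤k)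

LexLeqBelow-respʳ : Agree k h s → LexLeqBelow k g h → LexLeqBelow k g s
LexLeqBelow-respʳ h≈s g≤h i i<k g≈s =
  subst (_ ≤_) (h≈s i i<k) (g≤h i i<k (Agree-trans g≈s (Agree-sym (Agree-mono (<⇒≤ i<k) h≈s))))

LexLeqBelow-antisym : ∀ k → LexLeqBelow k g h → LexLeqBelow k h g → Agree k g h
LexLeqBelow-antisym zero    _   _   _ ()
LexLeqBelow-antisym (suc k) g≤h h≤g =
  Agree-suc g≈h (≤-antisym (g≤h k ≤-refl g≈h) (h≤g k ≤-refl (Agree-sym g≈h)))
  where
  g≈h = LexLeqBelow-antisym k (LexLeqBelow-mono (n≤1+n k) g≤h) (LexLeqBelow-mono (n≤1+n k) h≤g)

-- Codes of finite sequences

suc-pair : ∀ x y → suc (pair x y) ≡ 2 ^ x * suc (2 * y)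
suc-pair x y = suc-pred (2 ^ x * suc (2 * y)) {{m*n≢0 (2 ^ x) (suc (2 * y)) {{m^n≢0 2 x}}}}

2^*odd-injective : ∀ x y x′ y′ → 2 ^ x * suc (2 * y) ≡ 2 ^ x′ * suc (2 * y′) →
                   x ≡ x′ × y ≡ y′
2^*odd-injective zero y zero y′ e =
  refl , *-cancelˡ-≡ y y′ 2 (suc-injective (trans (sym (*-identityˡ _)) (trans e (*-identityˡ _))))
2^*odd-injective zero y (suc x′) y′ e = contradiction
  (trans (sym (*-assoc 2 (2 ^ x′) (suc (2 * y′)))) (trans (sym e) (*-identityˡ _)))
  (even≢odd (2 ^ x′ * suc (2 * y′)) y)
2^*odd-injective (suc x) y zero y′ e = contradiction
  (trans (sym (*-assoc 2 (2 ^ x) (suc (2 * y)))) (trans e (*-identityˡ _)))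
  (even≢odd (2 ^ x * suc (2 * y)) y′)
2^*odd-injective (suc x) y (suc x′) y′ e
  with 2^*odd-injective x y x′ y′
         (*-cancelˡ-≡ _ _ 2 (trans (sym (*-assoc 2 (2 ^ x) _)) (trans e (*-assoc 2 (2 ^ x′) _))))
... | refl , refl = refl , refl

pair-injective : ∀ x y x′ y′ → pair x y ≡ pair x′ y′ → x ≡ x′ × y ≡ y′
pair-injective x y x′ y′ e =
  2^*odd-injective x y x′ y′ (trans (sym (suc-pair x y)) (trans (cong suc e) (suc-pair x′ y′)))

code-injective : ∀ s s′ → code s ≡ code s′ → s ≡ s′
code-injective []      []        _ = refl
code-injective (x ∷ s) (x′ ∷ s′) e with pair-injective x (code s) x′ (code s′) (suc-injective e)
... | refl , e′ = cong (x ∷_) (code-injective s s′ e′)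

applyUpTo-cong : ∀ k → Agree k g h → applyUpTo g k ≡ applyUpTo h k
applyUpTo-cong zero    _   = refl
applyUpTo-cong (suc k) g≈h =
  cong₂ _∷_ (g≈h 0 z<s) (applyUpTo-cong k (λ j j<k → g≈h (suc j) (s<s j<k)))

applyUpTo-injective : ∀ k → applyUpTo g k ≡ applyUpTo h k → Agree k g h
applyUpTo-injective (suc k) e zero    _     = proj₁ (∷-injective e)
applyUpTo-injective (suc k) e (suc j) j<1+k =
  applyUpTo-injective k (proj₂ (∷-injective e)) j (s<s⁻¹ j<1+k)

applyUpTo-+ : ∀ (h : ℕ → ℕ) a k →
              applyUpTo h (a + k) ≡ applyUpTo h a ++ applyUpTo (λ i → h (a + i)) k
applyUpTo-+ h zero    k = refl
applyUpTo-+ h (suc a) k = cong (h 0 ∷_) (applyUpTo-+ (h ∘ suc) a k)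

bar≡code-applyUpTo : ∀ b k → bar b k ≡ code (applyUpTo b k)
bar≡code-applyUpTo b k = cong code (map-upTo b k)

bar-cong : Agree k g h → bar g k ≡ bar h k
bar-cong {k} {g} {h} g≈h = begin
  bar g k                 ≡⟨ bar≡code-applyUpTo g k ⟩
  code (applyUpTo g k)    ≡⟨ cong code (applyUpTo-cong k g≈h) ⟩
  code (applyUpTo h k)    ≡⟨ bar≡code-applyUpTo h k ⟨
  bar h k                 ∎
  where open ≡-Reasoning

bar-injective : bar g k ≡ bar h k → Agree k g h
bar-injective {g} {k} {h} e = applyUpTo-injective k (code-injective _ _
  (trans (sym (bar≡code-applyUpTo g k)) (trans e (bar≡code-applyUpTo h k))))

-- Binary trees

nth : List ℕ → ℕ → ℕ
nth []      _       = 0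
nth (x ∷ s) zero    = x
nth (x ∷ s) (suc i) = nth s i

applyUpTo-nth : ∀ s → applyUpTo (nth s) (length s) ≡ s
applyUpTo-nth []      = refl
applyUpTo-nth (x ∷ s) = cong (x ∷_) (applyUpTo-nth s)

module _ (tree : IsBinTree f) where

  bar-prefixClosed : a ≤ M → f (bar h M) ≡ 0 → f (bar h a) ≡ 0
  bar-prefixClosed {a} {M} {h} a≤M e with m≤n⇒∃[o]m+o≡n a≤M
  ... | k , refl = subst (λ c → f c ≡ 0) (sym (bar≡code-applyUpTo h a))
    (proj₁ tree (applyUpTo h a) _
      (subst (λ l → f (code l) ≡ 0) (trans (map-upTo h (a + k)) (applyUpTo-+ h a k)) e))

  nth-binary : ∀ p s → f (code (p ++ s)) ≡ 0 → Binary (nth s)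
  nth-binary p []      _ = λ _ → z≤n
  nth-binary p (y ∷ s) e = λ where
      zero    → proj₂ tree p y (proj₁ tree (p ++ [ y ]) s e′)
      (suc i) → nth-binary (p ++ [ y ]) s e′ i
    where
    e′ : f (code ((p ++ [ y ]) ++ s)) ≡ 0
    e′ = subst (λ l → f (code l) ≡ 0) (sym (++-assoc p [ y ] s)) e

infiniteTree-node : IsInfBinTree f → ∀ M → ∃ λ b → Binary b × f (bar b M) ≡ 0
infiniteTree-node {f} (tree , infinite) M with infinite M
... | s , refl , e = nth s , nth-binary {f} tree [] s e , subst (λ c → f c ≡ 0) (sym bar≡code) e
  where
  bar≡code : bar (nth s) (length s) ≡ code s
  bar≡code = trans (bar≡code-applyUpTo (nth s) (length s)) (cong code (applyUpTo-nth s))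

-- Leftmost prefixes of infinite paths

IsLeftmostPrefix : (ℕ → ℕ) → ℕ → (ℕ → ℕ) → Set
IsLeftmostPrefix f k s =
  (∃ λ P → IsPath f P × Agree k s P) × (∀ b → IsPath f b → LexLeqBelow k s b)

leftmostPrefix-mono : m ≤ k → IsLeftmostPrefix f k s → IsLeftmostPrefix f m s
leftmostPrefix-mono m≤k ((P , path , s≈P) , s≤paths) =
  (P , path , Agree-mono m≤k s≈P) , λ b path-b → LexLeqBelow-mono m≤k (s≤paths b path-b)

leftmostPrefix-unique : IsLeftmostPrefix f k g → IsLeftmostPrefix f k h → Agree k g h
leftmostPrefix-unique {k = k} ((P , path , g≈P) , g≤paths) ((Q , path′ , h≈Q) , h≤paths) =
  LexLeqBelow-antisym k (LexLeqBelow-respʳ (Agree-sym h≈Q) (g≤paths Q path′))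
                        (LexLeqBelow-respʳ (Agree-sym g≈P) (h≤paths P path))

IsLeftmostPath-cong : (∀ x → g x ≡ h x) → IsLeftmostPath f g → IsLeftmostPath f h
IsLeftmostPath-cong {g} {h} {f} g≗h ((g-binary , g-inTree) , g≤paths) =
  ((λ i → subst (_≤ 1) (g≗h i) (g-binary i)) ,
   (λ x → subst (λ c → f c ≡ 0) (bar-cong (λ j _ → g≗h j)) (g-inTree x))) ,
  λ b path i h≈b → subst (_≤ b i) (g≗h i) (g≤paths b path i (Agree-trans (λ j _ → g≗h j) h≈b))

module _ (t : ℕ → ℕ → ℕ) (t-leftmost : ∀ x → IsLeftmostPrefix f (suc x) (t x)) where

  private
    d : ℕ → ℕ
    d x = t x x

    d≈t : ∀ x → Agree (suc x) d (t x)
    d≈t x j j<1+x = leftmostPrefix-unique {f}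
      (t-leftmost j) (leftmostPrefix-mono {f = f} j<1+x (t-leftmost x)) j ≤-refl

  diagonal-isLeftmostPath : IsLeftmostPath f (λ x → t x x)
  diagonal-isLeftmostPath = (d-binary , d-inTree) , d≤paths
    where
    d-binary : Binary d
    d-binary x with proj₁ (t-leftmost x)
    ... | P , (P-binary , _) , t≈P = subst (_≤ 1) (sym (t≈P x ≤-refl)) (P-binary x)

    d-inTree : ∀ x → f (bar d x) ≡ 0
    d-inTree x with proj₁ (t-leftmost x)
    ... | P , (_ , P-inTree) , t≈P = subst (λ c → f c ≡ 0)
      (sym (bar-cong (Agree-mono (n≤1+n x) (Agree-trans (d≈t x) t≈P)))) (P-inTree x)

    d≤paths : ∀ b → IsPath f b → LexLeq d b
    d≤paths b path i d≈b = proj₂ (t-leftmost i) b path i ≤-refl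
      (Agree-trans (Agree-sym (Agree-mono (n≤1+n i) (d≈t i))) d≈b)

-- Bounded sums and products

sumBelow-cong : ∀ k → (∀ i → g i ≡ h i) → sumBelow k g ≡ sumBelow k h
sumBelow-cong zero    _   = refl
sumBelow-cong (suc k) g≗h = cong₂ _+_ (sumBelow-cong k g≗h) (g≗h k)

prodBelow-cong : ∀ k → (∀ i → g i ≡ h i) → prodBelow k g ≡ prodBelow k h
prodBelow-cong zero    _   = refl
prodBelow-cong (suc k) g≗h = cong₂ _*_ (prodBelow-cong k g≗h) (g≗h k)

sumBelow-const : ∀ k c → sumBelow k (λ _ → c) ≡ k * c
sumBelow-const zero    c = refl
sumBelow-const (suc k) c = trans (cong (_+ c) (sumBelow-const k c)) (+-comm (k * c) c)

prodBelow-const : ∀ k c → prodBelow k (λ _ → c) ≡ c ^ k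
prodBelow-const zero    c = refl
prodBelow-const (suc k) c = trans (cong (_* c) (prodBelow-const k c)) (*-comm (c ^ k) c)

sumBelow-suc : ∀ k (g : ℕ → ℕ) → sumBelow (suc k) g ≡ g 0 + sumBelow k (g ∘ suc)
sumBelow-suc zero    g = +-comm 0 (g 0)
sumBelow-suc (suc k) g = trans (cong (_+ g (suc k)) (sumBelow-suc k g)) (+-assoc (g 0) _ _)

*-distribˡ-sumBelow : ∀ k c (g : ℕ → ℕ) → c * sumBelow k g ≡ sumBelow k (λ j → c * g j)
*-distribˡ-sumBelow zero    c g = *-zeroʳ c
*-distribˡ-sumBelow (suc k) c g =
  trans (*-distribˡ-+ c _ _) (cong (_+ c * g k) (*-distribˡ-sumBelow k c g))

sumBelow-indicator : (∀ i → i < a → g i ≡ 1) → (∀ i → a ≤ i → g i ≡ 0) →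
                     ∀ k → sumBelow k g ≡ k ⊓ a
sumBelow-indicator         below above zero    = refl
sumBelow-indicator {a} {g} below above (suc k) with k <? a
... | yes k<a = begin
  sumBelow k g + g k  ≡⟨ cong₂ _+_ (sumBelow-indicator below above k) (below k k<a) ⟩
  k ⊓ a + 1           ≡⟨ cong (_+ 1) (m≤n⇒m⊓n≡m (<⇒≤ k<a)) ⟩
  k + 1               ≡⟨ +-comm k 1 ⟩
  suc k               ≡⟨ m≤n⇒m⊓n≡m k<a ⟨
  suc k ⊓ a           ∎
  where open ≡-Reasoning
... | no k≮a = begin
  sumBelow k g + g k  ≡⟨ cong₂ _+_ (sumBelow-indicator below above k) (above k (≮⇒≥ k≮a)) ⟩
  k ⊓ a + 0           ≡⟨ +-identityʳ _ ⟩
  k ⊓ a               ≡⟨ m≥n⇒m⊓n≡n (≮⇒≥ k≮a) ⟩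
  a                   ≡⟨ m≥n⇒m⊓n≡n (m≤n⇒m≤1+n (≮⇒≥ k≮a)) ⟨
  suc k ⊓ a           ∎
  where open ≡-Reasoning

sg : ℕ → ℕ
sg zero    = 0
sg (suc _) = 1

sg-nonZero : ∀ n → n ≢ 0 → sg n ≡ 1
sg-nonZero zero    n≢0 = contradiction refl n≢0
sg-nonZero (suc n) _   = refl

prodBelow-ones : ∀ k → (∀ i → i < k → g i ≡ 1) → prodBelow k g ≡ 1
prodBelow-ones zero    _    = refl
prodBelow-ones (suc k) ones =
  cong₂ _*_ (prodBelow-ones k (λ i i<k → ones i (m<n⇒m<1+n i<k))) (ones k ≤-refl)

prodBelow-zero : ∀ k → i < k → g i ≡ 0 → prodBelow k g ≡ 0
prodBelow-zero {i} {g} (suc k) i<1+k gi≡0 with m≤n⇒m<n∨m≡n (s≤s⁻¹ i<1+k)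
... | inj₁ i<k  = cong (_* g k) (prodBelow-zero k i<k gi≡0)
... | inj₂ refl = trans (cong (prodBelow k g *_) gi≡0) (*-zeroʳ (prodBelow k g))

leastZero : ∀ (F : ℕ → ℕ) m → F m ≡ 0 →
            ∃ λ k → k ≤ m × F k ≡ 0 × (∀ i → i < k → F i ≢ 0)
leastZero F zero    F0≡0 = 0 , z≤n , F0≡0 , λ _ ()
leastZero F (suc m) Fm≡0 with F 0 in F0
... | zero  = 0 , z≤n , F0 , λ _ ()
... | suc _ with leastZero (F ∘ suc) m Fm≡0
...   | k , k≤m , Fk≡0 , nonZero = suc k , s≤s k≤m , Fk≡0 , λ where
          zero    _     F0≡0 → 0≢1+n (trans (sym F0≡0) F0)
          (suc i) i<1+k      → nonZero i (s<s⁻¹ i<1+k)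

-- The i-th product is 1 exactly when F has no zero in [0, i], so the sum is the least zero of F
-- whenever F has a zero below N.
minBelow : ℕ → (ℕ → ℕ) → ℕ
minBelow N F = sumBelow N (λ i → prodBelow (suc i) (sg ∘ F))

minBelow-cong : ∀ N {F G : ℕ → ℕ} → (∀ i → F i ≡ G i) → minBelow N F ≡ minBelow N G
minBelow-cong N F≗G = sumBelow-cong N (λ i → prodBelow-cong (suc i) (cong sg ∘ F≗G))

minBelow-least : ∀ {N F} → m < N → F m ≡ 0 →
                 F (minBelow N F) ≡ 0 × (∀ i → F i ≡ 0 → minBelow N F ≤ i)
minBelow-least {m} {N} {F} m<N Fm≡0 with leastZero F m Fm≡0
... | k , k≤m , Fk≡0 , nonZero =
  subst (λ μ → F μ ≡ 0 × (∀ i → F i ≡ 0 → μ ≤ i)) (sym minBelow≡k) (Fk≡0 , least)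
  where
  before : ∀ i → i < k → prodBelow (suc i) (sg ∘ F) ≡ 1
  before i i<k = prodBelow-ones (suc i) λ j j<1+i →
    sg-nonZero (F j) (nonZero j (≤-<-trans (s≤s⁻¹ j<1+i) i<k))

  after : ∀ i → k ≤ i → prodBelow (suc i) (sg ∘ F) ≡ 0
  after i k≤i = prodBelow-zero (suc i) (s≤s k≤i) (cong sg Fk≡0)

  minBelow≡k : minBelow N F ≡ k
  minBelow≡k = trans (sumBelow-indicator before after N) (m≥n⇒m⊓n≡n (≤-trans k≤m (<⇒≤ m<N)))

  least : ∀ i → F i ≡ 0 → k ≤ i
  least i Fi≡0 = ≮⇒≥ (λ i<k → nonZero i i<k Fi≡0)

sumBelow-multiples≡/ : ∀ s d .{{_ : NonZero d}} →
                       sumBelow s (λ q → 1 ∸ (suc q * d ∸ s)) ≡ s / d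
sumBelow-multiples≡/ s d = trans (sumBelow-indicator below above s) (m≥n⇒m⊓n≡n (m/n≤m s d))
  where
  below : ∀ q → q < s / d → 1 ∸ (suc q * d ∸ s) ≡ 1
  below q q<s/d = cong (1 ∸_) (m≤n⇒m∸n≡0 (≤-trans (*-monoˡ-≤ d q<s/d) (m/n*n≤m s d)))

  above : ∀ q → s / d ≤ q → 1 ∸ (suc q * d ∸ s) ≡ 0
  above q s/d≤q = m≤n⇒m∸n≡0 (m<n⇒0<n∸m (≰⇒> λ [1+q]d≤s →
    <⇒≱ (s≤s s/d≤q) (≤-trans (≤-reflexive (sym (m*n/n≡m (suc q) d))) (/-monoˡ-≤ d [1+q]d≤s))))

-- Binary expansions

_/2^_ : ℕ → ℕ → ℕ
i /2^ k = (i / 2 ^ k) {{m^n≢0 2 k}}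

-- Bit l of the M-bit expansion of i, most significant bit first.
bits : ℕ → ℕ → ℕ → ℕ
bits M i l = i /2^ (M ∸ suc l) % 2

bits-binary : ∀ M i → Binary (bits M i)
bits-binary M i l = s≤s⁻¹ (m%n<n (i /2^ (M ∸ suc l)) 2)

/2^-suc : ∀ i k → i /2^ suc k ≡ i /2^ k / 2
/2^-suc i k = sym (trans
  (m/n/o≡m/[n*o] i (2 ^ k) 2 {{2^k≢0}} {{_}} {{m*n≢0 (2 ^ k) 2 {{2^k≢0}}}})
  (/-congʳ {{m*n≢0 (2 ^ k) 2 {{2^k≢0}}}} {{m^n≢0 2 (suc k)}} (*-comm (2 ^ k) 2)))
  where 2^k≢0 = m^n≢0 2 k

/2^-<2^ : i < 2 ^ k → i /2^ k ≡ 0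
/2^-<2^ {k = k} = m<n⇒m/n≡0 {{m^n≢0 2 k}}

/2^-monoˡ-≤ : ∀ k → i ≤ m → i /2^ k ≤ m /2^ k
/2^-monoˡ-≤ k = /-monoˡ-≤ (2 ^ k) {{m^n≢0 2 k}}

/2^-∸-suc : ∀ i → m < M → i /2^ (M ∸ suc m) ≡ bits M i m + i /2^ (M ∸ m) * 2
/2^-∸-suc {m} {M} i m<M = trans (m≡m%n+[m/n]*n (i /2^ (M ∸ suc m)) 2)
  (cong (λ q → bits M i m + q * 2)
    (sym (trans (cong (i /2^_) (+-∸-assoc 1 m<M)) (/2^-suc i (M ∸ suc m)))))

/2^-agree : ∀ {i i′} → i < 2 ^ M → i′ < 2 ^ M → ∀ j → j ≤ M →
            Agree j (bits M i) (bits M i′) → i /2^ (M ∸ j) ≡ i′ /2^ (M ∸ j)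
/2^-agree {M} i< i′< zero _ _ = trans (/2^-<2^ {k = M} i<) (sym (/2^-<2^ {k = M} i′<))
/2^-agree {M} {i} {i′} i< i′< (suc j) j<M agree = begin
  i /2^ (M ∸ suc j)                 ≡⟨ /2^-∸-suc i j<M ⟩
  bits M i j + i /2^ (M ∸ j) * 2    ≡⟨ cong₂ (λ c q → c + q * 2) (agree j ≤-refl) prefix ⟩
  bits M i′ j + i′ /2^ (M ∸ j) * 2  ≡⟨ /2^-∸-suc i′ j<M ⟨
  i′ /2^ (M ∸ suc j)                ∎
  where
  open ≡-Reasoning
  prefix = /2^-agree i< i′< j (<⇒≤ j<M) (Agree-mono (n≤1+n j) agree)

bits-lexMonotone : ∀ {i i′} → i ≤ i′ → i′ < 2 ^ M → LexLeqBelow M (bits M i) (bits M i′)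
bits-lexMonotone {M} {i} {i′} i≤i′ i′< j j<M agree =
  +-cancelʳ-≤ (i′ /2^ (M ∸ j) * 2) _ _ (begin
    bits M i j + i′ /2^ (M ∸ j) * 2   ≡⟨ cong (λ q → bits M i j + q * 2) prefix ⟨
    bits M i j + i /2^ (M ∸ j) * 2    ≡⟨ /2^-∸-suc i j<M ⟨
    i /2^ (M ∸ suc j)                 ≤⟨ /2^-monoˡ-≤ (M ∸ suc j) i≤i′ ⟩
    i′ /2^ (M ∸ suc j)                ≡⟨ /2^-∸-suc i′ j<M ⟩
    bits M i′ j + i′ /2^ (M ∸ j) * 2  ∎)
  where
  open ≤-Reasoning
  prefix = /2^-agree (≤-<-trans i≤i′ i′<) i′< j (<⇒≤ j<M) agree

fromBits : (ℕ → ℕ) → ℕ → ℕ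
fromBits b zero    = 0
fromBits b (suc j) = b j + fromBits b j * 2

fromBits<2^ : Binary b → ∀ M → fromBits b M < 2 ^ M
fromBits<2^ B zero = s≤s z≤n
fromBits<2^ {b} B (suc M) = begin-strict
  b M + fromBits b M * 2   ≤⟨ +-monoˡ-≤ (fromBits b M * 2) (B M) ⟩
  1 + fromBits b M * 2     <⟨ n<1+n _ ⟩
  suc (fromBits b M) * 2   ≤⟨ *-monoˡ-≤ 2 (fromBits<2^ B M) ⟩
  2 ^ M * 2                ≡⟨ *-comm (2 ^ M) 2 ⟩
  2 ^ suc M                ∎
  where open ≤-Reasoning

[c+n*2]/2≡n : ∀ {c} n → c ≤ 1 → (c + n * 2) / 2 ≡ n
[c+n*2]/2≡n {c} n c≤1 =
  trans (+-distrib-/-∣ʳ c (n∣m*n n)) (cong₂ _+_ (m<n⇒m/n≡0 (s≤s c≤1)) (m*n/n≡m n 2))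

fromBits-/2^ : Binary b → ∀ j k → fromBits b (j + k) /2^ k ≡ fromBits b j
fromBits-/2^ {b} B j zero = trans (n/1≡n _) (cong (fromBits b) (+-identityʳ j))
fromBits-/2^ {b} B j (suc k) = begin
  fromBits b (j + suc k) /2^ suc k    ≡⟨ /2^-suc _ k ⟩
  fromBits b (j + suc k) /2^ k / 2    ≡⟨ cong (λ n → fromBits b n /2^ k / 2) (+-suc j k) ⟩
  fromBits b (suc j + k) /2^ k / 2    ≡⟨ cong (_/ 2) (fromBits-/2^ B (suc j) k) ⟩
  (b j + fromBits b j * 2) / 2        ≡⟨ [c+n*2]/2≡n (fromBits b j) (B j) ⟩
  fromBits b j                        ∎
  where open ≡-Reasoning

bits-fromBits : Binary b → ∀ M → Agree M (bits M (fromBits b M)) b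
bits-fromBits {b} B M l l<M =
  subst (λ M → bits M (fromBits b M) l ≡ b l) (m+[n∸m]≡n l<M) (bit-l (M ∸ suc l))
  where
  open ≡-Reasoning
  bit-l : ∀ k → bits (suc l + k) (fromBits b (suc l + k)) l ≡ b l
  bit-l k = begin
    fromBits b (suc l + k) /2^ (suc l + k ∸ suc l) % 2
      ≡⟨ cong (λ e → fromBits b (suc l + k) /2^ e % 2) (m+n∸m≡n (suc l) k) ⟩
    fromBits b (suc l + k) /2^ k % 2
      ≡⟨ cong (_% 2) (fromBits-/2^ B (suc l) k) ⟩
    (b l + fromBits b l * 2) % 2
      ≡⟨ [m+kn]%n≡m%n (b l) (fromBits b l) 2 ⟩
    b l % 2
      ≡⟨ m<n⇒m%n≡m (s≤s (B l)) ⟩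
    b l
      ∎

-- code (x ∷ s) = 2 ^ x * (2 * code s + 1), which unfolds to this sum.
closedBar : (ℕ → ℕ) → ℕ → ℕ
closedBar b M = sumBelow M (λ j → 2 ^ (j + sumBelow (suc j) b))

code-applyUpTo≡closedBar : ∀ b M → code (applyUpTo b M) ≡ closedBar b M
code-applyUpTo≡closedBar b zero    = refl
code-applyUpTo≡closedBar b (suc M) = begin
  suc (pair (b 0) (code (applyUpTo (b ∘ suc) M)))
    ≡⟨ suc-pair (b 0) (code (applyUpTo (b ∘ suc) M)) ⟩
  2 ^ b 0 * suc (2 * code (applyUpTo (b ∘ suc) M))
    ≡⟨ cong (λ c → 2 ^ b 0 * suc (2 * c)) (code-applyUpTo≡closedBar (b ∘ suc) M) ⟩
  2 ^ b 0 * suc (2 * closedBar (b ∘ suc) M)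
    ≡⟨ unfold (2 ^ b 0) (closedBar (b ∘ suc) M) ⟩
  2 ^ b 0 + 2 ^ b 0 * 2 * closedBar (b ∘ suc) M
    ≡⟨ cong (2 ^ b 0 +_) (*-distribˡ-sumBelow M (2 ^ b 0 * 2) _) ⟩
  2 ^ b 0 + sumBelow M (λ j → 2 ^ b 0 * 2 * 2 ^ (j + sumBelow (suc j) (b ∘ suc)))
    ≡⟨ cong (2 ^ b 0 +_) (sumBelow-cong M term) ⟩
  2 ^ b 0 + sumBelow M (λ j → 2 ^ (suc j + sumBelow (suc (suc j)) b))
    ≡⟨ sumBelow-suc M (λ j → 2 ^ (j + sumBelow (suc j) b)) ⟨
  closedBar b (suc M)
    ∎
  where
  open ≡-Reasoning

  unfold : ∀ p c → p * suc (2 * c) ≡ p + p * 2 * c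
  unfold = solve-∀

  exponent : ∀ a j s → suc a + (j + s) ≡ suc j + (a + s)
  exponent = solve-∀

  term : ∀ j → 2 ^ b 0 * 2 * 2 ^ (j + sumBelow (suc j) (b ∘ suc)) ≡
               2 ^ (suc j + sumBelow (suc (suc j)) b)
  term j = begin
    2 ^ b 0 * 2 * 2 ^ (j + S)     ≡⟨ cong (_* 2 ^ (j + S)) (*-comm (2 ^ b 0) 2) ⟩
    2 ^ suc (b 0) * 2 ^ (j + S)   ≡⟨ ^-distribˡ-+-* 2 (suc (b 0)) (j + S) ⟨
    2 ^ (suc (b 0) + (j + S))     ≡⟨ cong (2 ^_) (exponent (b 0) j S) ⟩
    2 ^ (suc j + (b 0 + S))       ≡⟨ cong (λ e → 2 ^ (suc j + e)) (sumBelow-suc (suc j) b) ⟨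
    2 ^ (suc j + sumBelow (suc (suc j)) b) ∎
    where S = sumBelow (suc j) (b ∘ suc)

bar≡closedBar : ∀ b M → bar b M ≡ closedBar b M
bar≡closedBar b M = trans (bar≡code-applyUpTo b M) (code-applyUpTo≡closedBar b M)

-- Elementary terms

private variable
  n n′ : ℕ

ext : (Fin n → Fin n′) → Fin (suc n) → Fin (suc n′)
ext r Fin.zero    = Fin.zero
ext r (Fin.suc i) = Fin.suc (r i)

rename : (Fin n → Fin n′) → Elem n → Elem n′
rename r (var i)     = var (r i)
rename r zro         = zro
rename r (sc t)      = sc (rename r t)
rename r (add s t)   = add (rename r s) (rename r t)
rename r (monus s t) = monus (rename r s) (rename r t)
rename r (appF t)    = appF (rename r t)
rename r (appR t)    = appR (rename r t)
rename r (bsum t s)  = bsum (rename r t) (rename (ext r) s)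
rename r (bprod t s) = bprod (rename r t) (rename (ext r) s)

weaken : Elem n → Elem (suc n)
weaken = rename Fin.suc

lookup-ext : ∀ {r : Fin n → Fin n′} {xs : Vec ℕ n} {ys : Vec ℕ n′} →
             (∀ i → lookup ys (r i) ≡ lookup xs i) →
             ∀ a i → lookup (a ∷ ys) (ext r i) ≡ lookup (a ∷ xs) i
lookup-ext r-ok a Fin.zero    = refl
lookup-ext r-ok a (Fin.suc i) = r-ok i

#0 : Elem (suc n)
#0 = var Fin.zero

lit : ℕ → Elem n
lit zero    = zro
lit (suc k) = sc (lit k)

_*ᵉ_ : Elem n → Elem n → Elem n
a *ᵉ e = bsum a (weaken e)

2^ᵉ_ : Elem n → Elem n
2^ᵉ e = bprod e (lit 2)

sgᵉ : Elem n → Elem n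
sgᵉ e = monus (lit 1) (monus (lit 1) e)

_/ᵉ_ : Elem n → Elem n → Elem n
s /ᵉ d = bsum s (monus (lit 1) (monus (sc #0 *ᵉ weaken d) (weaken s)))

_%2ᵉ : Elem n → Elem n
e %2ᵉ = monus e ((e /ᵉ lit 2) *ᵉ lit 2)

bitsᵉ : Elem n → Elem n → Elem n → Elem n
bitsᵉ M i l = (i /ᵉ (2^ᵉ monus M (sc l))) %2ᵉ

closedBarᵉ : Elem n → Elem n → Elem n
closedBarᵉ M i =
  bsum M (2^ᵉ add #0 (bsum (sc #0) (bitsᵉ (weaken (weaken M)) (weaken (weaken i)) #0)))

minBelowᵉ : Elem n → Elem (suc n) → Elem n
minBelowᵉ N e = bsum N (bprod (sc #0) (sgᵉ (rename (ext Fin.suc) e)))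

1∸[1∸n]≡sg : ∀ n → 1 ∸ (1 ∸ n) ≡ sg n
1∸[1∸n]≡sg zero    = refl
1∸[1∸n]≡sg (suc n) = cong (1 ∸_) (0∸n≡0 n)

module Evaluation (f ρ : ℕ → ℕ) where

  eval : Elem n → Vec ℕ n → ℕ
  eval t = ⟦ t ⟧ f ρ

  eval-rename : ∀ (r : Fin n → Fin n′) t {xs ys} → (∀ i → lookup ys (r i) ≡ lookup xs i) →
                eval (rename r t) ys ≡ eval t xs
  eval-rename r (var i)     r-ok = r-ok i
  eval-rename r zro         r-ok = refl
  eval-rename r (sc t)      r-ok = cong suc (eval-rename r t r-ok)
  eval-rename r (add s t)   r-ok = cong₂ _+_ (eval-rename r s r-ok) (eval-rename r t r-ok)
  eval-rename r (monus s t) r-ok = cong₂ _∸_ (eval-rename r s r-ok) (eval-rename r t r-ok)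
  eval-rename r (appF t)    r-ok = cong f (eval-rename r t r-ok)
  eval-rename r (appR t)    r-ok = cong ρ (eval-rename r t r-ok)
  eval-rename r (bsum t s) {xs} {ys} r-ok = trans
    (cong (λ k → sumBelow k (λ i → eval (rename (ext r) s) (i ∷ ys))) (eval-rename r t r-ok))
    (sumBelow-cong (eval t xs) (λ i → eval-rename (ext r) s {i ∷ xs} {i ∷ ys} (lookup-ext r-ok i)))
  eval-rename r (bprod t s) {xs} {ys} r-ok = trans
    (cong (λ k → prodBelow k (λ i → eval (rename (ext r) s) (i ∷ ys))) (eval-rename r t r-ok))
    (prodBelow-cong (eval t xs) (λ i → eval-rename (ext r) s {i ∷ xs} {i ∷ ys} (lookup-ext r-ok i)))

  eval-weaken : ∀ (t : Elem n) a xs → eval (weaken t) (a ∷ xs) ≡ eval t xs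
  eval-weaken t a xs = eval-rename Fin.suc t (λ _ → refl)

  eval-weaken₂ : ∀ (t : Elem n) a a′ xs → eval (weaken (weaken t)) (a ∷ a′ ∷ xs) ≡ eval t xs
  eval-weaken₂ t a a′ xs = trans (eval-weaken (weaken t) a (a′ ∷ xs)) (eval-weaken t a′ xs)

  eval-*ᵉ : ∀ (a e : Elem n) xs → eval (a *ᵉ e) xs ≡ eval a xs * eval e xs
  eval-*ᵉ a e xs = trans (sumBelow-cong (eval a xs) (λ i → eval-weaken e i xs))
                         (sumBelow-const (eval a xs) (eval e xs))

  eval-2^ᵉ : ∀ (e : Elem n) xs → eval (2^ᵉ e) xs ≡ 2 ^ eval e xs
  eval-2^ᵉ e xs = prodBelow-const (eval e xs) 2

  eval-sgᵉ : ∀ (e : Elem n) xs → eval (sgᵉ e) xs ≡ sg (eval e xs)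
  eval-sgᵉ e xs = 1∸[1∸n]≡sg (eval e xs)

  eval-/ᵉ : ∀ (s d : Elem n) xs {D} .{{_ : NonZero D}} → eval d xs ≡ D →
            eval (s /ᵉ d) xs ≡ eval s xs / D
  eval-/ᵉ s d xs {D} d≡D = trans (sumBelow-cong (eval s xs) λ q →
      cong₂ (λ u v → 1 ∸ (u ∸ v))
        (trans (eval-*ᵉ (sc #0) (weaken d) (q ∷ xs)) (cong (suc q *_) (trans (eval-weaken d q xs) d≡D)))
        (eval-weaken s q xs))
    (sumBelow-multiples≡/ (eval s xs) D)

  eval-%2ᵉ : ∀ (e : Elem n) xs → eval (e %2ᵉ) xs ≡ eval e xs % 2
  eval-%2ᵉ e xs = trans
    (cong (eval e xs ∸_) (trans (eval-*ᵉ (e /ᵉ lit 2) (lit 2) xs) (cong (_* 2) (eval-/ᵉ e (lit 2) xs refl))))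
    (sym (m%n≡m∸m/n*n (eval e xs) 2))

  eval-bitsᵉ : ∀ (M i l : Elem n) xs →
               eval (bitsᵉ M i l) xs ≡ bits (eval M xs) (eval i xs) (eval l xs)
  eval-bitsᵉ M i l xs = trans (eval-%2ᵉ (i /ᵉ (2^ᵉ monus M (sc l))) xs)
    (cong (_% 2) (eval-/ᵉ i (2^ᵉ monus M (sc l)) xs {{m^n≢0 2 (eval M xs ∸ suc (eval l xs))}}
                          (eval-2^ᵉ (monus M (sc l)) xs)))

  eval-closedBarᵉ : ∀ (M i : Elem n) xs →
                    eval (closedBarᵉ M i) xs ≡ closedBar (bits (eval M xs) (eval i xs)) (eval M xs)
  eval-closedBarᵉ M i xs = sumBelow-cong (eval M xs) λ j →
    trans (eval-2^ᵉ (add #0 (bsum (sc #0) bitᵉ)) (j ∷ xs))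
          (cong (λ e → 2 ^ (j + e)) (sumBelow-cong (suc j) λ l →
            trans (eval-bitsᵉ (weaken (weaken M)) (weaken (weaken i)) #0 (l ∷ j ∷ xs))
                  (cong₂ (λ M′ i′ → bits M′ i′ l) (eval-weaken₂ M l j xs) (eval-weaken₂ i l j xs))))
    where bitᵉ = bitsᵉ (weaken (weaken M)) (weaken (weaken i)) #0

  eval-minBelowᵉ : ∀ (N : Elem n) e xs →
                   eval (minBelowᵉ N e) xs ≡ minBelow (eval N xs) (λ i → eval e (i ∷ xs))
  eval-minBelowᵉ N e xs = sumBelow-cong (eval N xs) λ i → prodBelow-cong (suc i) λ i′ →
    trans (eval-sgᵉ (rename (ext Fin.suc) e) (i′ ∷ i ∷ xs))
      (cong sg (eval-rename (ext Fin.suc) e {i′ ∷ xs} (lookup-ext (λ _ → refl) i′)))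

-- The leftmost-path functional

depth : (ℕ → ℕ) → ℕ → ℕ
depth ρ x = suc x + ρ (suc x)

leftmostNode : (ℕ → ℕ) → ℕ → ℕ
leftmostNode f M = minBelow (2 ^ M) (λ i → f (bar (bits M i) M))

approx : (ℕ → ℕ) → (ℕ → ℕ) → ℕ → ℕ → ℕ
approx f ρ x = bits (depth ρ x) (leftmostNode f (depth ρ x))

depthᵉ : Elem 1
depthᵉ = add (sc #0) (appR (sc #0))

leftmostNodeᵉ : Elem n → Elem n
leftmostNodeᵉ M = minBelowᵉ (2^ᵉ M) (appF (closedBarᵉ (weaken M) #0))

φ : Elem 1
φ = bitsᵉ depthᵉ (leftmostNodeᵉ depthᵉ) #0

eval-leftmostNodeᵉ : ∀ f ρ (M : Elem n) xs →
  Evaluation.eval f ρ (leftmostNodeᵉ M) xs ≡ leftmostNode f (Evaluation.eval f ρ M xs)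
eval-leftmostNodeᵉ f ρ M xs = begin
  eval (leftmostNodeᵉ M) xs
    ≡⟨ eval-minBelowᵉ (2^ᵉ M) (appF (closedBarᵉ (weaken M) #0)) xs ⟩
  minBelow (eval (2^ᵉ M) xs) F
    ≡⟨ cong (λ N → minBelow N F) (eval-2^ᵉ M xs) ⟩
  minBelow (2 ^ eval M xs) F
    ≡⟨ minBelow-cong (2 ^ eval M xs) (cong f ∘ F≗bar) ⟩
  leftmostNode f (eval M xs)
    ∎
  where
  open Evaluation f ρ
  open ≡-Reasoning

  F : ℕ → ℕ
  F i = f (eval (closedBarᵉ (weaken M) #0) (i ∷ xs))

  F≗bar : ∀ i → eval (closedBarᵉ (weaken M) #0) (i ∷ xs) ≡ bar (bits (eval M xs) i) (eval M xs)
  F≗bar i = begin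
    eval (closedBarᵉ (weaken M) #0) (i ∷ xs)
      ≡⟨ eval-closedBarᵉ (weaken M) #0 (i ∷ xs) ⟩
    closedBar (bits (eval (weaken M) (i ∷ xs)) i) (eval (weaken M) (i ∷ xs))
      ≡⟨ cong (λ m → closedBar (bits m i) m) (eval-weaken M i xs) ⟩
    closedBar (bits (eval M xs) i) (eval M xs)
      ≡⟨ bar≡closedBar (bits (eval M xs) i) (eval M xs) ⟨
    bar (bits (eval M xs) i) (eval M xs)
      ∎

eval-φ : ∀ f ρ x → apply1 φ f ρ x ≡ approx f ρ x x
eval-φ f ρ x = trans (eval-bitsᵉ depthᵉ (leftmostNodeᵉ depthᵉ) #0 (x ∷ []))
  (cong (λ μ → bits (depth ρ x) μ x) (eval-leftmostNodeᵉ f ρ depthᵉ (x ∷ [])))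
  where open Evaluation f ρ

leftmostNode-spec : IsInfBinTree f → ∀ M →
  f (bar (bits M (leftmostNode f M)) M) ≡ 0 ×
  (∀ b → Binary b → f (bar b M) ≡ 0 → LexLeqBelow M (bits M (leftmostNode f M)) b)
leftmostNode-spec {f} tree M with infiniteTree-node {f} tree M
... | b₀ , b₀-binary , b₀-inTree = proj₁ least , node≤nodes
  where
  encode : ∀ {b} → Binary b → f (bar b M) ≡ 0 → f (bar (bits M (fromBits b M)) M) ≡ 0
  encode B inTree = trans (cong f (bar-cong (bits-fromBits B M))) inTree

  least : f (bar (bits M (leftmostNode f M)) M) ≡ 0 ×
          (∀ i → f (bar (bits M i) M) ≡ 0 → leftmostNode f M ≤ i)
  least = minBelow-least (fromBits<2^ b₀-binary M) (encode b₀-binary b₀-inTree)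

  node≤nodes : ∀ b → Binary b → f (bar b M) ≡ 0 → LexLeqBelow M (bits M (leftmostNode f M)) b
  node≤nodes b B inTree = LexLeqBelow-respʳ (bits-fromBits B M)
    (bits-lexMonotone (proj₂ least (fromBits b M) (encode B inTree)) (fromBits<2^ B M))

approx-isLeftmostPrefix : IsInfBinTree f → IsModulusOfRegularity f ρ →
                          ∀ x → IsLeftmostPrefix f (suc x) (approx f ρ x)
approx-isLeftmostPrefix {f} {ρ} tree modulus x with leftmostNode-spec {f} tree (depth ρ x)
... | node-inTree , node≤nodes = extendable , λ b (B , inTree) →
  LexLeqBelow-mono (m≤m+n (suc x) (ρ (suc x))) (node≤nodes b B (inTree (depth ρ x)))
  where
  extendable : ∃ λ P → IsPath f P × Agree (suc x) (approx f ρ x) P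
  extendable with modulus (approx f ρ x) (bits-binary (depth ρ x) (leftmostNode f (depth ρ x))) (suc x)
                    (bar-prefixClosed {f} (proj₁ tree) (m≤n+m (ρ (suc x)) (suc x)) node-inTree)
  ... | P , path , bar≡ = P , path , bar-injective bar≡

proposition2p8 : Σ (Elem 1) λ φ →
    ∀ (f ρ : ℕ → ℕ) → IsInfBinTree f → IsModulusOfRegularity f ρ →
      IsLeftmostPath f (apply1 φ f ρ)
proposition2p8 = φ , λ f ρ tree modulus →
  IsLeftmostPath-cong {f = f} (λ x → sym (eval-φ f ρ x))
    (diagonal-isLeftmostPath {f} (approx f ρ) (approx-isLeftmostPrefix {f} {ρ} tree modulus))
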